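{- Let $s>0$ and let $z$ be a variable of type $A[\mathbf{B}^s]$. (1) If $A$ is a $\Pi_1$-type, then $\mathtt{sub}^s_A\,z\rightarrow^*_\beta z^A_A$. (2) If $A$ is a $\Sigma_1$-type, then $\overline{\mathtt{sub}}^s_A\,z\rightarrow^*_\beta z^A_A$.
   Context: Types of $\mathsf{IMLL}_2$: $A ::= \alpha\mid A\multimap A\mid\forall\alpha.A$. $\Pi_1 ::= \alpha\mid\Sigma_1\multimap\Pi_1\mid\forall\alpha.\Pi_1$ and $\Sigma_1 ::= \alpha\mid\Pi_1\multimap\Sigma_1$ (mutually defined). $\mathbf{B}=\forall\alpha.\alpha\multimap\alpha\multimap\alpha\otimes\alpha$ with $A\otimes B=\forall\alpha.(A\multimap B\multimap\alpha)\multimap\alpha$, and $\mathbf{B}^s$ is the $s$-fold tensor of $\mathbf{B}$; $A[\mathbf{B}^s]$ is $A$ with every free type variable replaced by $\mathbf{B}^s$. Linear $\lambda$-terms $\mathtt{sub}^s_A$ ($A$ a $\Pi_1$-type) and $\overline{\mathtt{sub}}^s_A$ ($A$ a $\Sigma_1$-type), by simultaneous induction: $\mathtt{sub}^s_\alpha=\overline{\mathtt{sub}}^s_\alpha=\lambda x.x$; $\mathtt{sub}^s_{\forall\alpha.B}=\mathtt{sub}^s_B$; $\mathtt{sub}^s_{B\multimap C}=\lambda x.\lambda y.\mathtt{sub}^s_C(x(\overline{\mathtt{sub}}^s_B\,y))$; $\overline{\mathtt{sub}}^s_{B\multimap C}=\lambda x.\lambda y.\overline{\mathtt{sub}}^s_C(x(\mathtt{sub}^s_B\,y))$.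 The $\eta$-long form of a term $M$ at type $A$, written $M^A_A$ when $M=z$ is a variable, is given by $\eta_\alpha(M)=M$, $\eta_{\forall\alpha.B}(M)=\eta_B(M)$, $\eta_{B\multimap C}(M)=\lambda y.\eta_C(M\,\eta_B(y))$ with $y$ fresh; $z^A_A:=\eta_A(z)$. -}

module Defs where

open import Data.Nat using (ℕ; zero; suc)
open import Relation.Binary.Construct.Closure.ReflexiveTransitive using (Star)

data Ty : Set where
  tvar : ℕ → Ty
  _⊸_  : Ty → Ty → Ty
  all  : ℕ → Ty → Ty

infixr 5 _⊸_

data Π₁ : Ty → Set
data Σ₁ : Ty → Set

data Π₁ where
  π-var : ∀ a → Π₁ (tvar a)
  π-⊸   : ∀ {B C} → Σ₁ B → Π₁ C → Π₁ (B ⊸ C)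
  π-∀   : ∀ {a B} → Π₁ B → Π₁ (all a B)

data Σ₁ where
  σ-var : ∀ a → Σ₁ (tvar a)
  σ-⊸   : ∀ {B C} → Π₁ B → Σ₁ C → Σ₁ (B ⊸ C)

data Term : Set where
  var : ℕ → Term
  lam : Term → Term
  app : Term → Term → Term

ext : (ℕ → ℕ) → ℕ → ℕ
ext ρ zero    = zero
ext ρ (suc n) = suc (ρ n)

rename : (ℕ → ℕ) → Term → Term
rename ρ (var i)   = var (ρ i)
rename ρ (lam M)   = lam (rename (ext ρ) M)
rename ρ (app M N) = app (rename ρ M) (rename ρ N)

exts : (ℕ → Term) → ℕ → Term
exts σ zero    = var zero
exts σ (suc n) = rename suc (σ n)

subst : (ℕ → Term) → Term → Term
subst σ (var i)   = σ i
subst σ (lam M)   = lam (subst (exts σ) M)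
subst σ (app M N) = app (subst σ M) (subst σ N)

sub0 : Term → ℕ → Term
sub0 N zero    = N
sub0 N (suc n) = var n

_[_] : Term → Term → Term
M [ N ] = subst (sub0 N) M

infix 4 _→β_ _→β*_
data _→β_ : Term → Term → Set where
  β     : ∀ {M N} → app (lam M) N →β M [ N ]
  ξ-lam : ∀ {M M'} → M →β M' → lam M →β lam M'
  ξ-appˡ : ∀ {M M' N} → M →β M' → app M N →β app M' N
  ξ-appʳ : ∀ {M N N'} → N →β N' → app M N →β app M N'

_→β*_ : Term → Term → Set
_→β*_ = Star _→β_

-- sub^s_A and sub-bar^s_A (closed terms; the index s does not affect the term)
sub    : ℕ → Ty → Term
subbar : ℕ → Ty → Term
sub s (tvar a)  = lam (var 0)
sub s (all a B) = sub s B
sub s (B ⊸ C)   = lam (lam (app (sub s C) (app (var 1) (app (subbar s B) (var 0)))))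
subbar s (tvar a)  = lam (var 0)
subbar s (all a B) = lam (var 0)   -- never used: ∀ does not occur in Σ₁-types
subbar s (B ⊸ C)   = lam (lam (app (subbar s C) (app (var 1) (app (sub s B) (var 0)))))

eta : Ty → Term → Term
eta (tvar a)  M = M
eta (all a B) M = eta B M
eta (B ⊸ C)   M = lam (eta C (app (rename suc M) (eta B (var 0))))

-- On B ⊸ C, a single β-step feeds M to
-- sub_{B ⊸ C}; the combinators sub_C and subbar_B inside are closed, so the
-- substitution leaves them untouched, and the induction hypotheses then turn
-- them into η-expansions under the remaining λ.
module Submission where

open import Defs
open import Data.Nat using (ℕ; suc; _>_)
open import Data.Product using (_×_; _,_)
open import Relation.Binary.PropositionalEquality
  using (_≡_; refl; cong; cong₂) renaming (subst to ≡-subst)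
open import Relation.Binary.Construct.Closure.ReflexiveTransitive using (ε; _◅_; _◅◅_; gmap)

Closed : Term → Set
Closed M = ∀ σ → subst σ M ≡ M

sub-closed    : ∀ s A → Closed (sub s A)
subbar-closed : ∀ s A → Closed (subbar s A)
sub-closed s (tvar a)  σ = refl
sub-closed s (all a B) σ = sub-closed s B σ
sub-closed s (B ⊸ C)   σ =
  cong₂ (λ c b → lam (lam (app c (app (var 1) (app b (var 0))))))
        (sub-closed s C _) (subbar-closed s B _)
subbar-closed s (tvar a)  σ = refl
subbar-closed s (all a B) σ = refl
subbar-closed s (B ⊸ C)   σ =
  cong₂ (λ c b → lam (lam (app c (app (var 1) (app b (var 0))))))
        (subbar-closed s C _) (sub-closed s B _)

lam-→β* : ∀ {M N} → M →β* N → lam M →β* lam N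
lam-→β* = gmap lam ξ-lam

appʳ-→β* : ∀ {M N N'} → N →β* N' → app M N →β* app M N'
appʳ-→β* {M} = gmap (app M) ξ-appʳ

β-conjugate : ∀ {f g} → Closed f → Closed g → ∀ M →
  app (lam (lam (app f (app (var 1) (app g (var 0)))))) M
    →β lam (app f (app (rename suc M) (app g (var 0))))
β-conjugate {f} {g} f-closed g-closed M =
  ≡-subst (app (lam (lam (app f (app (var 1) (app g (var 0)))))) M →β_)
    (cong lam (cong₂ (λ f' g' → app f' (app (rename suc M) (app g' (var 0))))
                     (f-closed _) (g-closed _)))
    β

sub-→β*-eta    : ∀ s {A} → Π₁ A → ∀ M → app (sub s A) M →β* eta A M
subbar-→β*-eta : ∀ s {A} → Σ₁ A → ∀ M → app (subbar s A) M →β* eta A M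
sub-→β*-eta s (π-var a) M = β ◅ ε
sub-→β*-eta s (π-∀ p)   M = sub-→β*-eta s p M
sub-→β*-eta s (π-⊸ {B} {C} q p) M =
  β-conjugate (sub-closed s C) (subbar-closed s B) M
    ◅ lam-→β* (appʳ-→β* (appʳ-→β* (subbar-→β*-eta s q (var 0))) ◅◅ sub-→β*-eta s p _)
subbar-→β*-eta s (σ-var a) M = β ◅ ε
subbar-→β*-eta s (σ-⊸ {B} {C} q p) M =
  β-conjugate (subbar-closed s C) (sub-closed s B) M
    ◅ lam-→β* (appʳ-→β* (appʳ-→β* (sub-→β*-eta s q (var 0))) ◅◅ subbar-→β*-eta s p _)

lemmaA6 : (s : ℕ) → s > 0 → (z : ℕ) → (A : Ty) →
    (Π₁ A → app (sub s A) (var z) →β* eta A (var z)) ×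
    (Σ₁ A → app (subbar s A) (var z) →β* eta A (var z))
lemmaA6 s _ z A = (λ p → sub-→β*-eta s p (var z)) , (λ q → subbar-→β*-eta s q (var z))
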